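{- Let $G$ be a finite, non-trivial abelian group, let $S$ be a proper subset of $G$, and let $p$ denote the smallest order of a non-zero subgroup of $G$. If $\mathrm{Cay}^+_G(S)$ is connected, then $\kappa(\mathrm{Cay}^+_G(S))\ge\min\{|S|-1,\,p\}$.
   Context: For a subset $S$ of an abelian group $G$ (written additively), the addition Cayley graph $\mathrm{Cay}^+_G(S)$ is the undirected graph with vertex set $G$ in which $g_1,g_2$ are adjacent iff $g_1+g_2\in S$ (loops allowed). For a graph $\Gamma$ on a finite vertex set, $\kappa(\Gamma)$ is the smallest number of vertices whose removal leaves a graph that is disconnected or has only one vertex. -}

module Defs where

open import Data.Nat using (ℕ; _≤_; _<_)
open import Data.Fin using (Fin)
open import Data.Fin.Subset using (Subset; _∈_; _∉_; ∣_∣)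
open import Data.Product using (Σ; ∃; _×_)
open import Data.Sum using (_⊎_)
open import Relation.Nullary using (¬_)
open import Relation.Binary.PropositionalEquality using (_≡_; _≢_)
open import Algebra.Structures using (IsAbelianGroup)

-- A finite abelian group, with its elements labelled by Fin order
-- (every finite abelian group is of this form up to relabelling).
record FinAbGroup : Set where
  field
    order          : ℕ
    _+_            : Fin order → Fin order → Fin order
    0#             : Fin order
    -_             : Fin order → Fin order
    isAbelianGroup : IsAbelianGroup _≡_ _+_ 0# -_

module _ (G : FinAbGroup) where
  open FinAbGroup G

  NonTrivial : Set
  NonTrivial = 1 < order

  Proper : Subset order → Set
  Proper S = ∃ λ g → g ∉ S

  IsSubgroup : Subset order → Set
  IsSubgroup H = (0# ∈ H)
               × (∀ x y → x ∈ H → y ∈ H → (x + y) ∈ H)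
               × (∀ x → x ∈ H → (- x) ∈ H)

  IsNonzeroSubgroup : Subset order → Set
  IsNonzeroSubgroup H = IsSubgroup H × (∃ λ h → h ∈ H × h ≢ 0#)

  IsSmallestNonzeroSubgroupOrder : ℕ → Set
  IsSmallestNonzeroSubgroupOrder p =
    (∃ λ H → IsNonzeroSubgroup H × ∣ H ∣ ≡ p)
    × (∀ H → IsNonzeroSubgroup H → p ≤ ∣ H ∣)

  Adj⁺ : Subset order → Fin order → Fin order → Set
  Adj⁺ S g₁ g₂ = (g₁ + g₂) ∈ S

  -- Walks in Cay⁺_G(S) − X (all vertices avoid X; start vertex is assumed outside X).
  data Walk (S X : Subset order) : Fin order → Fin order → Set where
    [] : ∀ {x} → Walk S X x x
    _∷_ : ∀ {x y z} → (Adj⁺ S x y × y ∉ X) → Walk S X y z → Walk S X x z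

  ConnectedWithout : Subset order → Subset order → Set
  ConnectedWithout S X = ∀ x y → x ∉ X → y ∉ X → Walk S X x y

  ∅ : Subset order
  ∅ = Data.Fin.Subset.⊥

  Connected : Subset order → Set
  Connected S = ConnectedWithout S ∅

  Separates : Subset order → Subset order → Set
  Separates S X = ¬ ConnectedWithout S X ⊎ (Data.Nat._∸_ order ∣ X ∣ ≤ 1)

  κ≥ : Subset order → ℕ → Set
  κ≥ S k = ∀ X → Separates S X → k ≤ ∣ X ∣

-- Suppose |X| < min(|S| - 1, p) and let A be the set of vertices reached from x in
-- Cay⁺(S) - X. If a ∈ A, s ∈ S and s - a ∉ X then s - a ∈ A, so the sumset D = S + (-A)
-- lies in A ∪ X; hence |D| ≤ |S| + |-A| - 2 and |D| < |-A| + p. A Kneser-type theorem,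
-- proved by induction with Dyson's e-transform, makes such a sumset periodic, so its
-- stabiliser H is a nonzero subgroup and |H| ≥ p > |X|. Since both H and S are larger
-- than X, the set A + H is closed under adjacency in the whole graph Cay⁺(S); connectivity
-- then puts every vertex outside X into A. Finally |X| ≤ |S| - 2 ≤ |G| - 3 leaves at least
-- two vertices, so X does not separate.

module Submission where

open import Defs
open import Data.Nat using (ℕ; _∸_; _⊓_)
open import Data.Fin.Subset using (Subset; ∣_∣)

open import Data.Bool using (Bool; true; false; _∧_; _∨_; not; if_then_else_)
open import Data.Empty using (⊥; ⊥-elim)
open import Data.Fin using (Fin; zero; suc)
open import Data.Product using (∃; _×_; _,_; proj₁; proj₂)
open import Data.Sum using (_⊎_; inj₁; inj₂)
open import Function using (id; _∘_)
open import Relation.Nullary using (¬_; yes; no)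
open import Relation.Binary.PropositionalEquality

-- Subsets of Fin n are handled as Boolean predicates, so that sumsets, stabilisers and
-- reachable sets are computable; ∣∣≡count and its companions relate them to Data.Fin.Subset.
Pred : ℕ → Set
Pred n = Fin n → Bool

infix 4 _∋_ _∌_

_∋_ : ∀ {n} → Pred n → Fin n → Set
P ∋ x = P x ≡ true

_∌_ : ∀ {n} → Pred n → Fin n → Set
P ∌ x = P x ≡ false

infix 4 _⊆_

_⊆_ : ∀ {n} → Pred n → Pred n → Set
P ⊆ Q = ∀ x → P ∋ x → Q ∋ x

module Counting where

  open import Data.Nat using (zero; suc; _+_; _≤_; _<_; z≤n; s≤s)
  open import Data.Nat.Properties
    using (≤-reflexive; ≤-trans; ≤-pred; <⇒≱; n≤1+n; m≤n⇒m≤1+n; +-suc; +-mono-≤; +-monoʳ-≤;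
           module ≤-Reasoning)
  open import Data.Bool.Properties using (∧-identityʳ)
  open import Data.Fin using (_≟_)
  open import Data.Fin.Properties using (suc-injective; 0≢1+n)
  open import Function.Definitions using (Injective)
  open import Relation.Nullary using (does)
  open import Relation.Nullary.Decidable using (dec-true; dec-false)
  open import Data.Vec using ([]; _∷_; lookup; tabulate)
  open import Data.Vec.Properties using (lookup⇒[]=; []=⇒lookup; lookup∘tabulate)
  open import Data.Fin.Subset using (_∈_; _∉_)

  true≢false : ∀ {b} → b ≡ true → b ≡ false → ⊥
  true≢false refl ()

  ∧-true⁻ˡ : ∀ {a b} → a ∧ b ≡ true → a ≡ true
  ∧-true⁻ˡ {true} _ = refl

  ∧-true⁻ʳ : ∀ {a b} → a ∧ b ≡ true → b ≡ true
  ∧-true⁻ʳ {true} e = e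

  ∧-true⁺ : ∀ {a b} → a ≡ true → b ≡ true → a ∧ b ≡ true
  ∧-true⁺ refl refl = refl

  ∧-false⁻ : ∀ {a b} → a ∧ b ≡ false → a ≡ true → b ≡ false
  ∧-false⁻ e refl = e

  ∨-true⁺ˡ : ∀ {a b} → a ≡ true → a ∨ b ≡ true
  ∨-true⁺ˡ refl = refl

  ∨-true⁺ʳ : ∀ {a b} → b ≡ true → a ∨ b ≡ true
  ∨-true⁺ʳ {true} _ = refl
  ∨-true⁺ʳ {false} e = e

  ∨-true⁻ : ∀ {a b} → a ∨ b ≡ true → a ≡ true ⊎ b ≡ true
  ∨-true⁻ {true} _ = inj₁ refl
  ∨-true⁻ {false} e = inj₂ e

  not-true⁺ : ∀ {a} → a ≡ false → not a ≡ true
  not-true⁺ refl = refl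

  not-true⁻ : ∀ {a} → not a ≡ true → a ≡ false
  not-true⁻ {false} _ = refl

  not-false⁻ : ∀ {a} → not a ≡ false → a ≡ true
  not-false⁻ {true} _ = refl

  ≢true⇒≡false : ∀ {a} → ¬ a ≡ true → a ≡ false
  ≢true⇒≡false {true} a≢ = ⊥-elim (a≢ refl)
  ≢true⇒≡false {false} _ = refl

  Bool-ext : ∀ {a b} → (a ≡ true → b ≡ true) → (b ≡ true → a ≡ true) → a ≡ b
  Bool-ext {true} a⇒b _ = sym (a⇒b refl)
  Bool-ext {false} {true} _ b⇒a = b⇒a refl
  Bool-ext {false} {false} _ _ = refl

  any : ∀ {n} → Pred n → Bool
  any {zero} P = false
  any {suc n} P = P zero ∨ any (P ∘ suc)

  any⁺ : ∀ {n} (P : Pred n) i → P ∋ i → any P ≡ true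
  any⁺ P zero Pi = ∨-true⁺ˡ Pi
  any⁺ P (suc i) Pi = ∨-true⁺ʳ {P zero} (any⁺ (P ∘ suc) i Pi)

  any⁻ : ∀ {n} (P : Pred n) → any P ≡ true → ∃ λ i → P ∋ i
  any⁻ {suc n} P e with ∨-true⁻ {P zero} e
  ... | inj₁ P0 = zero , P0
  ... | inj₂ e′ with any⁻ (P ∘ suc) e′
  ...   | i , Pi = suc i , Pi

  any-false⁻ : ∀ {n} (P : Pred n) → any P ≡ false → ∀ i → P ∌ i
  any-false⁻ P e i = ≢true⇒≡false λ Pi → true≢false (any⁺ P i Pi) e

  count : ∀ {n} → Pred n → ℕ
  count {zero} P = 0
  count {suc n} P = (if P zero then suc else id) (count (P ∘ suc))

  count-cong : ∀ {n} {P Q : Pred n} → (∀ i → P i ≡ Q i) → count P ≡ count Q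
  count-cong {zero} eq = refl
  count-cong {suc n} {P} {Q} eq
    rewrite eq zero | count-cong {P = P ∘ suc} {Q ∘ suc} (eq ∘ suc) = refl

  count≤n : ∀ {n} (P : Pred n) → count P ≤ n
  count≤n {zero} P = z≤n
  count≤n {suc n} P with P zero
  ... | true = s≤s (count≤n (P ∘ suc))
  ... | false = m≤n⇒m≤1+n (count≤n (P ∘ suc))

  infixr 7 _∩_
  infixr 6 _∪_ _∖_

  _∩_ _∪_ _∖_ : ∀ {n} → Pred n → Pred n → Pred n
  (P ∩ Q) i = P i ∧ Q i
  (P ∪ Q) i = P i ∨ Q i
  (P ∖ Q) i = P i ∧ not (Q i)

  ｛_｝ : ∀ {n} → Fin n → Pred n
  ｛ j ｝ i = does (i ≟ j)

  ｛j｝∋j : ∀ {n} (j : Fin n) → ｛ j ｝ ∋ j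
  ｛j｝∋j j = dec-true (j ≟ j) refl

  ｛j｝∋i⇒i≡j : ∀ {n} {i j : Fin n} → ｛ j ｝ ∋ i → i ≡ j
  ｛j｝∋i⇒i≡j {i = i} {j} e with i ≟ j | e
  ... | yes i≡j | _ = i≡j
  ... | no _ | ()

  ∖｛｝⁺ : ∀ {n} {P : Pred n} {i j} → P ∋ i → i ≢ j → (P ∖ ｛ j ｝) ∋ i
  ∖｛｝⁺ {i = i} {j} Pi i≢j = ∧-true⁺ Pi (not-true⁺ (dec-false (i ≟ j) i≢j))

  ∖｛｝⇒≢ : ∀ {n} {P : Pred n} {i j} → (P ∖ ｛ j ｝) ∋ i → i ≢ j
  ∖｛｝⇒≢ {i = i} {j} e refl = true≢false (｛j｝∋j i) (not-true⁻ (∧-true⁻ʳ e))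

  count-∖｛｝ : ∀ {n} (P : Pred n) {j} → P ∋ j → count P ≡ suc (count (P ∖ ｛ j ｝))
  count-∖｛｝ {suc n} P {zero} P0 rewrite P0 =
    cong suc (count-cong λ i → sym (∧-identityʳ (P (suc i))))
  count-∖｛｝ {suc n} P {suc j} Pj with P zero
  ... | true = cong suc (count-∖｛｝ (P ∘ suc) Pj)
  ... | false = count-∖｛｝ (P ∘ suc) Pj

  count-pos : ∀ {n} (P : Pred n) {j} → P ∋ j → 1 ≤ count P
  count-pos P Pj rewrite count-∖｛｝ P Pj = s≤s z≤n

  count-injection : ∀ {m n} (P : Pred m) (Q : Pred n) (f : Fin m → Fin n) →
    Injective _≡_ _≡_ f → (∀ i → P ∋ i → Q ∋ f i) → count P ≤ count Q
  count-injection {zero} P Q f f-inj P⇒Q = z≤n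
  count-injection {suc m} P Q f f-inj P⇒Q with P zero in P0
  ... | false = count-injection (P ∘ suc) Q (f ∘ suc) (suc-injective ∘ f-inj) (P⇒Q ∘ suc)
  ... | true rewrite count-∖｛｝ Q (P⇒Q zero P0) =
    s≤s (count-injection (P ∘ suc) (Q ∖ ｛ f zero ｝) (f ∘ suc) (suc-injective ∘ f-inj)
          λ i Pi → ∖｛｝⁺ {P = Q} (P⇒Q (suc i) Pi) (0≢1+n ∘ sym ∘ f-inj))

  count-mono : ∀ {n} {P Q : Pred n} → P ⊆ Q → count P ≤ count Q
  count-mono {P = P} {Q} = count-injection P Q id id

  count-< : ∀ {n} {P Q : Pred n} {j} → P ⊆ Q → Q ∋ j → P ∌ j →
    count P < count Q
  count-< {P = P} {Q} {j} P⊆Q Qj Pj rewrite count-∖｛｝ Q Qj =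
    s≤s (count-mono λ i Pi → ∖｛｝⁺ {P = Q} (P⊆Q i Pi) λ { refl → true≢false Pi Pj })

  count-pos⇒∃ : ∀ {n} (P : Pred n) → 1 ≤ count P → ∃ λ i → P ∋ i
  count-pos⇒∃ P 1≤ with any P in e
  ... | true = any⁻ P e
  ... | false = ⊥-elim (<⇒≱ 1≤ (≤-reflexive (count-none P (any-false⁻ P e))))
    where
    count-none : ∀ {n} (P : Pred n) → (∀ i → P ∌ i) → count P ≡ 0
    count-none {zero} P none = refl
    count-none {suc n} P none rewrite none zero = count-none (P ∘ suc) (none ∘ suc)

  count-≥2⇒∃≢ : ∀ {n} (P : Pred n) {j} → P ∋ j → 2 ≤ count P → ∃ λ i → P ∋ i × i ≢ j
  count-≥2⇒∃≢ P {j} Pj 2≤ rewrite count-∖｛｝ P Pj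
    with count-pos⇒∃ (P ∖ ｛ j ｝) (≤-pred 2≤)
  ... | i , i∈ = i , ∧-true⁻ˡ i∈ , ∖｛｝⇒≢ {P = P} i∈

  count-∩+∖ : ∀ {n} (P Q : Pred n) → count P ≡ count (P ∩ Q) + count (P ∖ Q)
  count-∩+∖ {zero} P Q = refl
  count-∩+∖ {suc n} P Q with P zero | Q zero
  ... | false | _ = count-∩+∖ (P ∘ suc) (Q ∘ suc)
  ... | true | true = cong suc (count-∩+∖ (P ∘ suc) (Q ∘ suc))
  ... | true | false = trans (cong suc (count-∩+∖ (P ∘ suc) (Q ∘ suc))) (sym (+-suc _ _))

  count-∪ : ∀ {n} (P Q : Pred n) → count (P ∪ Q) ≤ count P + count Q
  count-∪ {zero} P Q = z≤n
  count-∪ {suc n} P Q with P zero | Q zero | count-∪ (P ∘ suc) (Q ∘ suc)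
  ... | true | true | ih = s≤s (≤-trans ih (+-monoʳ-≤ (count (P ∘ suc)) (n≤1+n _)))
  ... | true | false | ih = s≤s ih
  ... | false | true | ih = ≤-trans (s≤s ih) (≤-reflexive (sym (+-suc _ _)))
  ... | false | false | ih = ih

  image : ∀ {m n} → (Fin m → Fin n) → Pred m → Pred n
  image f P y = any λ i → P i ∧ ｛ y ｝ (f i)

  image⁺ : ∀ {m n} (f : Fin m → Fin n) {P : Pred m} {i} → P ∋ i → image f P ∋ f i
  image⁺ f {P} {i} Pi = any⁺ _ i (∧-true⁺ Pi (｛j｝∋j (f i)))

  image⁻ : ∀ {m n} (f : Fin m → Fin n) {P : Pred m} {y} → image f P ∋ y →
    ∃ λ i → P ∋ i × f i ≡ y
  image⁻ f e = let i , e′ = any⁻ _ e in i , ∧-true⁻ˡ e′ , ｛j｝∋i⇒i≡j (∧-true⁻ʳ e′)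

  count-disjoint-injections : ∀ {m k n} (P : Pred m) (Q : Pred k) (R : Pred n)
    (f : Fin m → Fin n) (g : Fin k → Fin n) → Injective _≡_ _≡_ f → Injective _≡_ _≡_ g →
    (∀ i → P ∋ i → R ∋ f i) → (∀ j → Q ∋ j → R ∋ g j) →
    (∀ i j → P ∋ i → Q ∋ j → f i ≢ g j) → count P + count Q ≤ count R
  count-disjoint-injections P Q R f g f-inj g-inj P⇒R Q⇒R disjoint = begin
    count P + count Q                             ≤⟨ +-mono-≤ P≤ Q≤ ⟩
    count (R ∩ image f P) + count (R ∖ image f P) ≡⟨ count-∩+∖ R (image f P) ⟨
    count R                                       ∎
    where
    open ≤-Reasoning
    P≤ : count P ≤ count (R ∩ image f P)
    P≤ = count-injection P _ f f-inj λ i Pi → ∧-true⁺ (P⇒R i Pi) (image⁺ f Pi)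
    Q≤ : count Q ≤ count (R ∖ image f P)
    Q≤ = count-injection Q _ g g-inj λ j Qj → ∧-true⁺ (Q⇒R j Qj) (not-true⁺ (≢true⇒≡false λ gj∈ →
           let i , Pi , fi≡gj = image⁻ f gj∈ in disjoint i j Pi Qj fi≡gj))

  count<⇒∃∌ : ∀ {m n} (Q : Pred m) (X : Pred n) (f : Fin m → Fin n) → Injective _≡_ _≡_ f →
    count X < count Q → ∃ λ i → Q ∋ i × X ∌ f i
  count<⇒∃∌ Q X f f-inj X<Q with any (Q ∖ (X ∘ f)) in e
  ... | true = let i , i∈ = any⁻ _ e in i , ∧-true⁻ˡ i∈ , not-true⁻ (∧-true⁻ʳ i∈)
  ... | false = ⊥-elim (<⇒≱ X<Q (count-injection Q X f f-inj λ i Qi →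
                  not-false⁻ (∧-false⁻ (any-false⁻ _ e i) Qi)))

  ∣∣≡count : ∀ {n} (S : Subset n) → ∣ S ∣ ≡ count (lookup S)
  ∣∣≡count [] = refl
  ∣∣≡count (true ∷ S) = cong suc (∣∣≡count S)
  ∣∣≡count (false ∷ S) = ∣∣≡count S

  ∈⇒∋ : ∀ {n} {S : Subset n} {x} → x ∈ S → lookup S ∋ x
  ∈⇒∋ = []=⇒lookup

  ∋⇒∈ : ∀ {n} {S : Subset n} {x} → lookup S ∋ x → x ∈ S
  ∋⇒∈ {S = S} {x} = lookup⇒[]= x S

  ∉⇒∌ : ∀ {n} {S : Subset n} {x} → x ∉ S → lookup S ∌ x
  ∉⇒∌ x∉S = ≢true⇒≡false (x∉S ∘ ∋⇒∈)

  ∌⇒∉ : ∀ {n} {S : Subset n} {x} → lookup S ∌ x → x ∉ S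
  ∌⇒∉ S∌x x∈S = true≢false (∈⇒∋ x∈S) S∌x

  ∣tabulate∣≡count : ∀ {n} (P : Pred n) → ∣ tabulate P ∣ ≡ count P
  ∣tabulate∣≡count P = trans (∣∣≡count (tabulate P)) (count-cong (lookup∘tabulate P))

  ∈tabulate⁺ : ∀ {n} (P : Pred n) {x} → P ∋ x → x ∈ tabulate P
  ∈tabulate⁺ P {x} Px = ∋⇒∈ (trans (lookup∘tabulate P x) Px)

  ∈tabulate⁻ : ∀ {n} (P : Pred n) {x} → x ∈ tabulate P → P ∋ x
  ∈tabulate⁻ P {x} x∈ = trans (sym (lookup∘tabulate P x)) (∈⇒∋ x∈)

open Counting

module _ (G : FinAbGroup) where

  open import Algebra.Bundles using (AbelianGroup)
  open import Data.Fin.Subset using (_∈_; _∉_)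
  open import Data.Fin.Subset.Properties using (∉⊥)
  open import Data.Vec using (lookup; tabulate)
  open import Data.Nat using (_≤_; _<_; z≤n; s≤s; _≤?_) renaming (_+_ to _+ℕ_)
  import Data.Nat as ℕ
  open import Data.Nat.Properties
    using (≤-reflexive; ≤-trans; ≤-pred; ≤-antisym; <-irrefl; <-≤-trans; <⇒≱; ≰⇒>;
           +-assoc; +-comm; +-suc; +-identityʳ; +-monoˡ-≤; +-monoʳ-≤; +-monoʳ-<; +-cancelʳ-≤;
           m≤n+m; m<m+n; m≤n+m∸n; m⊓n≤m; m⊓n≤n; +-commutativeSemigroup; module ≤-Reasoning)
  open import Function.Definitions using (Injective)
  open import Algebra.Properties.CommutativeSemigroup +-commutativeSemigroup
    using () renaming (xy∙z≈xz∙y to m+n+o≡m+o+n)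

  open FinAbGroup G using (order; 0#; isAbelianGroup)

  Element : Set
  Element = Fin order

  infixl 6 _+_ _-_
  infix 8 -_

  _+_ : Element → Element → Element
  _+_ = FinAbGroup._+_ G

  -_ : Element → Element
  -_ = FinAbGroup.-_ G

  _-_ : Element → Element → Element
  x - y = x + - y

  abelianGroup : AbelianGroup _ _
  abelianGroup = record
    { Carrier = Element ; _≈_ = _≡_ ; _∙_ = _+_ ; ε = 0# ; _⁻¹ = -_
    ; isAbelianGroup = isAbelianGroup }

  open AbelianGroup abelianGroup
    using (assoc; comm; identityˡ; identityʳ; inverseʳ; commutativeSemigroup)
  open import Algebra.Properties.AbelianGroup abelianGroup
    using (⁻¹-involutive; ⁻¹-∙-comm; ⁻¹-anti-homo‿-; ε⁻¹≈ε; ⁻¹-injective; ∙-cancelˡ; ∙-cancelʳ;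
           //-rightDividesˡ; //-rightDividesʳ; x∙y⁻¹≈ε⇒x≈y)
  open import Algebra.Properties.CommutativeSemigroup commutativeSemigroup
    using (xy∙z≈xz∙y; x∙yz≈y∙xz)

  x-0≡x : ∀ x → x - 0# ≡ x
  x-0≡x x = trans (cong (x +_) ε⁻¹≈ε) (identityʳ x)

  x+y-x≡y : ∀ x y → x + y - x ≡ y
  x+y-x≡y x y = trans (cong (_- x) (comm x y)) (//-rightDividesʳ x y)

  x+[y-x]≡y : ∀ x y → x + (y - x) ≡ y
  x+[y-x]≡y x y = trans (comm x (y - x)) (//-rightDividesˡ x y)

  x-y-z≡x-[y+z] : ∀ x y z → x - y - z ≡ x - (y + z)
  x-y-z≡x-[y+z] x y z = trans (assoc x (- y) (- z)) (cong (x +_) (⁻¹-∙-comm y z))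

  x-[y-z]≡x-y+z : ∀ x y z → x - (y - z) ≡ x - y + z
  x-[y-z]≡x-y+z x y z = begin
    x - (y - z)      ≡⟨ cong (x +_) (⁻¹-anti-homo‿- y z) ⟩
    x + (z - y)      ≡⟨ cong (x +_) (comm z (- y)) ⟩
    x + (- y + z)    ≡⟨ assoc x (- y) z ⟨
    x - y + z        ∎
    where open ≡-Reasoning

  x+y-z≡x-z+y : ∀ x y z → x + y - z ≡ x - z + y
  x+y-z≡x-z+y x y z = xy∙z≈xz∙y x y (- z)

  x+y+z-y≡x+z : ∀ x y z → x + y + z - y ≡ x + z
  x+y+z-y≡x+z x y z = trans (cong (_- y) (xy∙z≈xz∙y x y z)) (//-rightDividesʳ y (x + z))

  x+y+[z-x]≡z+y : ∀ x y z → x + y + (z - x) ≡ z + y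
  x+y+[z-x]≡z+y x y z = begin
    x + y + (z - x)  ≡⟨ cong (_+ (z - x)) (comm x y) ⟩
    y + x + (z - x)  ≡⟨ assoc y x (z - x) ⟩
    y + (x + (z - x)) ≡⟨ cong (y +_) (x+[y-x]≡y x z) ⟩
    y + z            ≡⟨ comm y z ⟩
    z + y            ∎
    where open ≡-Reasoning

  x+y-[x-z]≡z+y : ∀ x y z → x + y - (x - z) ≡ z + y
  x+y-[x-z]≡z+y x y z = begin
    x + y - (x - z)  ≡⟨ x-[y-z]≡x-y+z (x + y) x z ⟩
    x + y - x + z    ≡⟨ cong (_+ z) (x+y-x≡y x y) ⟩
    y + z            ≡⟨ comm y z ⟩
    z + y            ∎
    where open ≡-Reasoning

  x-[x-y]≡y : ∀ x y → x - (x - y) ≡ y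
  x-[x-y]≡y x y = trans (x-[y-z]≡x-y+z x x y)
    (trans (cong (_+ y) (inverseʳ x)) (identityˡ y))

  x-[x-y-z]≡y+z : ∀ x y z → x - (x - y - z) ≡ y + z
  x-[x-y-z]≡y+z x y z = trans (x-[y-z]≡x-y+z x (x - y) z) (cong (_+ z) (x-[x-y]≡y x y))

  x+[y-z]≡y+[x-z] : ∀ x y z → x + (y - z) ≡ y + (x - z)
  x+[y-z]≡y+[x-z] x y z = x∙yz≈y∙xz x y (- z)

  x+[y-z]-[x-z]≡y : ∀ x y z → x + (y - z) - (x - z) ≡ y
  x+[y-z]-[x-z]≡y x y z = begin
    x + (y - z) - (x - z)  ≡⟨ x-[y-z]≡x-y+z (x + (y - z)) x z ⟩
    x + (y - z) - x + z    ≡⟨ cong (_+ z) (x+y-x≡y x (y - z)) ⟩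
    y - z + z              ≡⟨ //-rightDividesˡ z y ⟩
    y                      ∎
    where open ≡-Reasoning

  x-y-[x-z]≡z-y : ∀ x y z → x - y - (x - z) ≡ z - y
  x-y-[x-z]≡z-y x y z = begin
    x - y - (x - z)  ≡⟨ x-[y-z]≡x-y+z (x - y) x z ⟩
    x - y - x + z    ≡⟨ cong (_+ z) (x+y-x≡y x (- y)) ⟩
    - y + z          ≡⟨ comm (- y) z ⟩
    z - y            ∎
    where open ≡-Reasoning

  +-cancelˡ : ∀ x → Injective _≡_ _≡_ (x +_)
  +-cancelˡ x = ∙-cancelˡ x _ _

  +-cancelʳ : ∀ x → Injective _≡_ _≡_ (_+ x)
  +-cancelʳ x = ∙-cancelʳ x _ _

  infixl 6 _⊞_

  _⊞_ : Pred order → Pred order → Pred order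
  (U ⊞ V) x = any λ u → U u ∧ V (x - u)

  ⊞-intro : ∀ {U V} u {x} → U ∋ u → V ∋ x - u → (U ⊞ V) ∋ x
  ⊞-intro u Uu Vx-u = any⁺ _ u (∧-true⁺ Uu Vx-u)

  ⊞⁺ : ∀ {U V : Pred order} {u v} → U ∋ u → V ∋ v → (U ⊞ V) ∋ u + v
  ⊞⁺ {U} {V} {u} {v} Uu Vv = ⊞-intro {U} {V} u Uu (subst (V ∋_) (sym (x+y-x≡y u v)) Vv)

  ⊞⁻ : ∀ {U V x} → (U ⊞ V) ∋ x → ∃ λ u → U ∋ u × V ∋ x - u
  ⊞⁻ x∈ = let u , e = any⁻ _ x∈ in u , ∧-true⁻ˡ e , ∧-true⁻ʳ e

  Period : Pred order → Element → Set
  Period P h = ∀ x → P ∋ x → P ∋ x + h × P ∋ x - h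

  stabiliser : Pred order → Pred order
  stabiliser P h = not (any λ x → P x ∧ not (P (x + h) ∧ P (x - h)))

  stabiliser⇒Period : ∀ P {h} → stabiliser P ∋ h → Period P h
  stabiliser⇒Period P h∈ x Px =
    let both = not-false⁻ (∧-false⁻ (any-false⁻ _ (not-true⁻ h∈) x) Px)
    in ∧-true⁻ˡ both , ∧-true⁻ʳ both

  Period⇒stabiliser : ∀ P {h} → Period P h → stabiliser P ∋ h
  Period⇒stabiliser P period = not-true⁺ (≢true⇒≡false λ e →
    let x , x∈ = any⁻ _ e
        Px+h , Px-h = period x (∧-true⁻ˡ x∈)
    in true≢false (∧-true⁺ Px+h Px-h) (not-true⁻ (∧-true⁻ʳ x∈)))

  stabiliser∌⇒∃ : ∀ P {h} → stabiliser P ∌ h → ∃ λ x → P ∋ x × (P ∌ x + h ⊎ P ∌ x - h)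
  stabiliser∌⇒∃ P {h} h∉ with any⁻ _ (not-false⁻ h∉)
  ... | x , x∈ = x , ∧-true⁻ˡ x∈ , escape (not-true⁻ (∧-true⁻ʳ x∈))
    where
    escape : ∀ {a b} → a ∧ b ≡ false → a ≡ false ⊎ b ≡ false
    escape {false} _ = inj₁ refl
    escape {true} e = inj₂ e

  Period-0 : ∀ P → Period P 0#
  Period-0 P x Px = subst (P ∋_) (sym (identityʳ x)) Px , subst (P ∋_) (sym (x-0≡x x)) Px

  Period-+ : ∀ P {a b} → Period P a → Period P b → Period P (a + b)
  Period-+ P {a} {b} Pa Pb x Px =
    subst (P ∋_) (assoc x a b) (proj₁ (Pb _ (proj₁ (Pa x Px)))) ,
    subst (P ∋_) (x-y-z≡x-[y+z] x a b) (proj₂ (Pb _ (proj₂ (Pa x Px))))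

  Period-neg : ∀ P {a} → Period P a → Period P (- a)
  Period-neg P {a} Pa x Px =
    proj₂ (Pa x Px) , subst (P ∋_) (cong (x +_) (sym (⁻¹-involutive a))) (proj₁ (Pa x Px))

  Period-cong : ∀ {P Q h} → (∀ x → P x ≡ Q x) → Period P h → Period Q h
  Period-cong {P} {Q} P≗Q period x Qx =
    let Px+h , Px-h = period x (trans (P≗Q x) Qx)
    in trans (sym (P≗Q _)) Px+h , trans (sym (P≗Q _)) Px-h

  count+count-stabiliser≤ : ∀ P W (g : Element → Element) → Injective _≡_ _≡_ g →
    ∀ {w d} → P ∋ w → P ∌ w + d → (∀ v → W ∋ v → P ∋ g v × P ∋ g v + d) →
    count W +ℕ count (stabiliser P) ≤ count P
  count+count-stabiliser≤ P W g g-inj {w} {d} Pw Pw+d W⇒P =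
    count-disjoint-injections W (stabiliser P) P g (w +_) g-inj (+-cancelˡ w)
      (λ v Wv → proj₁ (W⇒P v Wv)) (λ h h∈ → proj₁ (stabiliser⇒Period P h∈ w Pw)) disjoint
    where
    disjoint : ∀ v h → W ∋ v → stabiliser P ∋ h → g v ≢ w + h
    disjoint v h Wv h∈ gv≡w+h = true≢false Pw+d′ Pw+d
      where
      P[w+h+d] : P ∋ w + h + d
      P[w+h+d] = subst (λ y → P ∋ y + d) gv≡w+h (proj₂ (W⇒P v Wv))
      Pw+d′ : P ∋ w + d
      Pw+d′ = subst (P ∋_) (x+y+z-y≡x+z w h d) (proj₂ (stabiliser⇒Period P h∈ _ P[w+h+d]))

  -- If t = u′ - u were not a period of P′, the translates u + v (v ∈ V) inside P′ would be
  -- disjoint from a coset of the stabiliser of P′, and those outside P′ still lie in P: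
  -- together |P| ≥ |V| + |stabiliser P′|.
  Period-from-translates : ∀ {p} P P′ V u u′ → P′ ⊆ P →
    (∀ v → V ∋ v → P′ ∋ u′ + v) → (∀ v → V ∋ v → P ∋ u + v) →
    count P < count V +ℕ p → p ≤ count (stabiliser P′) → Period P′ (u′ - u)
  Period-from-translates {p} P P′ V u u′ P′⊆P u′+V⊆P′ u+V⊆P P-small stab-large
    with stabiliser P′ (u′ - u) in e
  ... | true = stabiliser⇒Period P′ e
  ... | false with stabiliser∌⇒∃ P′ e
  ...   | w , P′w , escape = ⊥-elim (<⇒≱ P-small P-large)
    where
    t : Element
    t = u′ - u
    hit : Pred order
    hit v = P′ (u + v)
    Vin Vout : Pred order
    Vin = V ∩ hit
    Vout = V ∖ hit
    Vin-bound : count Vin +ℕ count (stabiliser P′) ≤ count P′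
    Vin-bound = bound escape
      where
      bound : P′ ∌ w + t ⊎ P′ ∌ w - t → count Vin +ℕ count (stabiliser P′) ≤ count P′
      bound (inj₁ P′∌w+t) = count+count-stabiliser≤ P′ Vin (u +_) (+-cancelˡ u) P′w P′∌w+t
        λ v v∈ → ∧-true⁻ʳ v∈ , subst (P′ ∋_) (sym (x+y+[z-x]≡z+y u v u′)) (u′+V⊆P′ v (∧-true⁻ˡ v∈))
      bound (inj₂ P′∌w-t) = count+count-stabiliser≤ P′ Vin (u′ +_) (+-cancelˡ u′) P′w P′∌w-t
        λ v v∈ → u′+V⊆P′ v (∧-true⁻ˡ v∈) , subst (P′ ∋_) (sym (x+y-[x-z]≡z+y u′ v u)) (∧-true⁻ʳ v∈)
    Vout-bound : count P′ +ℕ count Vout ≤ count P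
    Vout-bound = count-disjoint-injections P′ Vout P id (u +_) id (+-cancelˡ u) P′⊆P
      (λ v v∈ → u+V⊆P v (∧-true⁻ˡ v∈))
      (λ x v P′x v∈ x≡u+v → true≢false (subst (P′ ∋_) x≡u+v P′x) (not-true⁻ (∧-true⁻ʳ v∈)))
    P-large : count V +ℕ p ≤ count P
    P-large = begin
      count V +ℕ p                                    ≤⟨ +-monoʳ-≤ (count V) stab-large ⟩
      count V +ℕ count (stabiliser P′)                ≡⟨ cong (_+ℕ _) (count-∩+∖ V hit) ⟩
      count Vin +ℕ count Vout +ℕ count (stabiliser P′) ≡⟨ m+n+o≡m+o+n (count Vin) _ _ ⟩
      count Vin +ℕ count (stabiliser P′) +ℕ count Vout ≤⟨ +-monoˡ-≤ (count Vout) Vin-bound ⟩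
      count P′ +ℕ count Vout                          ≤⟨ Vout-bound ⟩
      count P                                         ∎
      where open ≤-Reasoning

  DifferencesArePeriods : Pred order → Pred order → Set
  DifferencesArePeriods U V = ∀ {u u′} → U ∋ u → U ∋ u′ → Period (U ⊞ V) (u - u′)

  AbsorbsDifferencesOf : Pred order → Pred order → Set
  AbsorbsDifferencesOf V U = ∀ {v u u′} → V ∋ v → U ∋ u → U ∋ u′ → V ∋ v + (u - u′)

  absorbs⊎escapes : ∀ U V → AbsorbsDifferencesOf V U ⊎
    ∃ λ v → ∃ λ u → ∃ λ u′ → V ∋ v × U ∋ u × U ∋ u′ × V ∌ v + (u - u′)
  absorbs⊎escapes U V
    with any (λ v → V v ∧ any λ u → U u ∧ any λ u′ → U u′ ∧ not (V (v + (u - u′)))) in e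
  ... | false = inj₁ λ {v} {u} {u′} Vv Uu Uu′ → not-false⁻ (∧-false⁻ (any-false⁻ _
          (∧-false⁻ (any-false⁻ _ (∧-false⁻ (any-false⁻ _ e v) Vv) u) Uu) u′) Uu′)
  ... | true with any⁻ _ e
  ...   | v , e₁ with any⁻ _ (∧-true⁻ʳ e₁)
  ...     | u , e₂ with any⁻ _ (∧-true⁻ʳ e₂)
  ...       | u′ , e₃ = inj₂ (v , u , u′ , ∧-true⁻ˡ e₁ , ∧-true⁻ˡ e₂ , ∧-true⁻ˡ e₃ ,
                               not-true⁻ (∧-true⁻ʳ e₃))

  absorbs⇒DifferencesArePeriods : ∀ U V → AbsorbsDifferencesOf V U → DifferencesArePeriods U V
  absorbs⇒DifferencesArePeriods U V absorbs {u} {u′} Uu Uu′ x x∈ =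
    let u₁ , Uu₁ , Vx-u₁ = ⊞⁻ {U} {V} x∈
    in ⊞-intro {U} {V} u₁ Uu₁
         (subst (V ∋_) (sym (x+y-z≡x-z+y x (u - u′) u₁)) (absorbs Vx-u₁ Uu Uu′)) ,
       ⊞-intro {U} {V} u₁ Uu₁ (subst (V ∋_) (sym (x+y-z≡x-z+y x (- (u - u′)) u₁))
         (subst (λ d → V ∋ x - u₁ + d) (sym (⁻¹-anti-homo‿- u u′)) (absorbs Vx-u₁ Uu′ Uu)))

  module ETransform (U V : Pred order) (e : Element) where

    U′ V′ : Pred order
    U′ = U ∩ (λ w → V (w + e))
    V′ = V ∪ (λ y → U (y - e))

    U′⊞V′⊆U⊞V : U′ ⊞ V′ ⊆ U ⊞ V
    U′⊞V′⊆U⊞V x x∈ with ⊞⁻ {U′} {V′} x∈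
    ... | u , U′u , V′x-u with ∨-true⁻ {V (x - u)} V′x-u
    ...   | inj₁ Vx-u = ⊞-intro {U} {V} u (∧-true⁻ˡ U′u) Vx-u
    ...   | inj₂ Ux-u-e = ⊞-intro {U} {V} (x - u - e) Ux-u-e
            (subst (V ∋_) (sym (x-[x-y-z]≡y+z x u e)) (∧-true⁻ʳ U′u))

    count-U+V≤count-U′+V′ : count U +ℕ count V ≤ count U′ +ℕ count V′
    count-U+V≤count-U′+V′ = begin
      count U +ℕ count V                ≡⟨ cong (_+ℕ count V) (count-∩+∖ U _) ⟩
      count U′ +ℕ count D +ℕ count V    ≡⟨ m+n+o≡m+o+n (count U′) _ _ ⟩
      count U′ +ℕ count V +ℕ count D    ≡⟨ +-assoc (count U′) _ _ ⟩
      count U′ +ℕ (count V +ℕ count D)  ≤⟨ +-monoʳ-≤ (count U′) V+D≤V′ ⟩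
      count U′ +ℕ count V′              ∎
      where
      open ≤-Reasoning
      D : Pred order
      D = U ∖ (λ w → V (w + e))
      V+D≤V′ : count V +ℕ count D ≤ count V′
      V+D≤V′ = count-disjoint-injections V D V′ id (_+ e) id (+-cancelʳ e)
        (λ v Vv → ∨-true⁺ˡ Vv)
        (λ w w∈ → ∨-true⁺ʳ {V (w + e)} (subst (U ∋_) (sym (//-rightDividesʳ e w)) (∧-true⁻ˡ w∈)))
        (λ v w Vv w∈ v≡w+e → true≢false (subst (V ∋_) v≡w+e Vv) (not-true⁻ (∧-true⁻ʳ w∈)))

    U′⊆U : U′ ⊆ U
    U′⊆U _ = ∧-true⁻ˡ

    V⊆V′ : V ⊆ V′
    V⊆V′ _ = ∨-true⁺ˡ

  SmallSumset : Pred order → Pred order → Set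
  SmallSumset U V = count (U ⊞ V) +ℕ 2 ≤ count U +ℕ count V

  SmallSumset⇒2≤count : ∀ {U V u₀} → U ∋ u₀ → SmallSumset U V → 2 ≤ count U
  SmallSumset⇒2≤count {U} {V} {u₀} Uu₀ small = +-cancelʳ-≤ (count V) 2 (count U) (begin
    2 +ℕ count V          ≤⟨ +-monoʳ-≤ 2 V≤U⊞V ⟩
    2 +ℕ count (U ⊞ V)    ≡⟨ +-comm 2 _ ⟩
    count (U ⊞ V) +ℕ 2    ≤⟨ small ⟩
    count U +ℕ count V    ∎)
    where
    open ≤-Reasoning
    V≤U⊞V : count V ≤ count (U ⊞ V)
    V≤U⊞V = count-injection V (U ⊞ V) (u₀ +_) (+-cancelˡ u₀) λ v → ⊞⁺ {U} {V} Uu₀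

  nonzero-Period : ∀ {U V u₀} → U ∋ u₀ → SmallSumset U V → DifferencesArePeriods U V →
    ∃ λ h → h ≢ 0# × Period (U ⊞ V) h
  nonzero-Period {U} {V} {u₀} Uu₀ small periods
    with count-≥2⇒∃≢ U Uu₀ (SmallSumset⇒2≤count {U} {V} Uu₀ small)
  ... | u₁ , Uu₁ , u₁≢u₀ = u₁ - u₀ , u₁≢u₀ ∘ x∙y⁻¹≈ε⇒x≈y u₁ u₀ , periods Uu₁ Uu₀

  NonzeroStabilisersHaveSize≥ : ℕ → Set
  NonzeroStabilisersHaveSize≥ p = ∀ P {h} → h ≢ 0# → Period P h → p ≤ count (stabiliser P)

  module _ {p} (large : NonzeroStabilisersHaveSize≥ p) where

    p≤count-stabiliser : ∀ {U V u₀} → U ∋ u₀ → SmallSumset U V → DifferencesArePeriods U V →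
      p ≤ count (stabiliser (U ⊞ V))
    p≤count-stabiliser {U} {V} Uu₀ small periods =
      let h , h≢0 , period = nonzero-Period {U} {V} Uu₀ small periods in large (U ⊞ V) h≢0 period

    -- Unless V + (U - U) ⊆ V, the e-transform with e = v₀ - u′ strictly shrinks U; the
    -- induction hypothesis gives U′ ⊞ V′ a stabiliser of size ≥ p, so Period-from-translates
    -- makes every u′ - w (w ∈ U) a period of U′ ⊞ V′, which forces U′ ⊞ V′ = U ⊞ V.
    differences-are-periods : ∀ k {U V u₀} → count U ≤ k → U ∋ u₀ → SmallSumset U V →
      count (U ⊞ V) < count V +ℕ p → DifferencesArePeriods U V
    differences-are-periods ℕ.zero {U} U≤0 Uu₀ _ _ = ⊥-elim (<⇒≱ (count-pos U Uu₀) U≤0)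
    differences-are-periods (ℕ.suc k) {U} {V} U≤1+k Uu₀ small P-small with absorbs⊎escapes U V
    ... | inj₁ absorbs = absorbs⇒DifferencesArePeriods U V absorbs
    ... | inj₂ (v₀ , u , u′ , Vv₀ , Uu , Uu′ , V∌v₀+u-u′) = result
      where
      open ETransform U V (v₀ - u′)
      P P′ : Pred order
      P = U ⊞ V
      P′ = U′ ⊞ V′
      U′u′ : U′ ∋ u′
      U′u′ = ∧-true⁺ Uu′ (subst (V ∋_) (sym (x+[y-x]≡y u′ v₀)) Vv₀)
      U′∌u : U′ ∌ u
      U′∌u = cong₂ _∧_ Uu (trans (cong V (x+[y-z]≡y+[x-z] u v₀ u′)) V∌v₀+u-u′)
      P′≤P : count P′ ≤ count P
      P′≤P = count-mono U′⊞V′⊆U⊞V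
      small′ : SmallSumset U′ V′
      small′ = ≤-trans (+-monoˡ-≤ 2 P′≤P) (≤-trans small count-U+V≤count-U′+V′)
      P′-small : count P′ < count V′ +ℕ p
      P′-small = ≤-trans (s≤s P′≤P) (≤-trans P-small (+-monoˡ-≤ p (count-mono V⊆V′)))
      U′≤k : count U′ ≤ k
      U′≤k = ≤-pred (≤-trans (count-< {P = U′} {U} U′⊆U Uu U′∌u) U≤1+k)
      IH : DifferencesArePeriods U′ V′
      IH = differences-are-periods k U′≤k U′u′ small′ P′-small
      u′-w-Period : ∀ {w} → U ∋ w → Period P′ (u′ - w)
      u′-w-Period {w} Uw = Period-from-translates P P′ V w u′ U′⊞V′⊆U⊞V
        (λ v Vv → ⊞⁺ {U′} {V′} U′u′ (V⊆V′ v Vv)) (λ v → ⊞⁺ {U} {V} Uw) P-small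
        (p≤count-stabiliser {U′} {V′} U′u′ small′ IH)
      P⊆P′ : P ⊆ P′
      P⊆P′ x x∈ =
        let u₁ , Uu₁ , Vx-u₁ = ⊞⁻ {U} {V} x∈
            P′∋ = ⊞⁺ {U′} {V′} U′u′ (V⊆V′ _ Vx-u₁)
        in subst (P′ ∋_) (x+[y-z]-[x-z]≡y u′ x u₁) (proj₂ (u′-w-Period Uu₁ _ P′∋))
      P′≗P : ∀ x → P′ x ≡ P x
      P′≗P x = Bool-ext (U′⊞V′⊆U⊞V x) (P⊆P′ x)
      result : DifferencesArePeriods U V
      result {a} {b} Ua Ub = Period-cong P′≗P (subst (Period P′) (x-y-[x-z]≡z-y u′ b a)
        (Period-+ P′ (u′-w-Period Ub) (Period-neg P′ (u′-w-Period Ua))))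

  walk-preserves : ∀ {S X} (W : Pred order) → (∀ {z w} → W ∋ z → Adj⁺ G S z w → W ∋ w) →
    ∀ {a b} → Walk G S X a b → W ∋ a → W ∋ b
  walk-preserves W closed [] Wa = Wa
  walk-preserves W closed ((adj , _) ∷ walk) Wa = walk-preserves W closed walk (closed Wa adj)

  Closed : Subset order → Subset order → Pred order → Set
  Closed S X A = ∀ {z w} → A ∋ z → w ∉ X → Adj⁺ G S z w → A ∋ w

  module Separation (S X : Subset order) {p} (large : NonzeroStabilisersHaveSize≥ p)
    (X+2≤S : count (lookup X) +ℕ 2 ≤ count (lookup S)) (X<p : count (lookup X) < p)
    {A : Pred order} (A-closed : Closed S X A) where

    Sᵇ Xᵇ -A D : Pred order
    Sᵇ = lookup S
    Xᵇ = lookup X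
    -A v = A (- v)
    D = Sᵇ ⊞ -A

    D∋s-a : ∀ {s a} → Sᵇ ∋ s → A ∋ a → D ∋ s - a
    D∋s-a {s} {a} Ss Aa = ⊞-intro {Sᵇ} { -A} s Ss
      (subst (A ∋_) (sym (trans (⁻¹-anti-homo‿- (s - a) s) (x-[x-y]≡y s a))) Aa)

    D∖X⊆A : ∀ {z} → D ∋ z → Xᵇ ∌ z → A ∋ z
    D∖X⊆A {z} z∈ Xᵇ∌z =
      let s , Ss , A∋-[z-s] = ⊞⁻ {Sᵇ} { -A} z∈
          s-z+z≡s = trans (cong (_+ z) (⁻¹-anti-homo‿- z s)) (//-rightDividesˡ z s)
      in A-closed A∋-[z-s] (∌⇒∉ Xᵇ∌z) (∋⇒∈ (subst (Sᵇ ∋_) (sym s-z+z≡s) Ss))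

    count-D≤ : count D ≤ count A +ℕ count Xᵇ
    count-D≤ = ≤-trans (count-mono D⊆A∪X) (count-∪ A Xᵇ)
      where
      D⊆A∪X : D ⊆ A ∪ Xᵇ
      D⊆A∪X z z∈ with Xᵇ z in Xᵇz
      ... | true = ∨-true⁺ʳ {A z} refl
      ... | false = ∨-true⁺ˡ (D∖X⊆A z∈ Xᵇz)

    count-A≡count-[-A] : count A ≡ count -A
    count-A≡count-[-A] = ≤-antisym
      (count-injection A -A -_ ⁻¹-injective λ a Aa → subst (A ∋_) (sym (⁻¹-involutive a)) Aa)
      (count-injection -A A -_ ⁻¹-injective λ _ → id)

    X<S : count Xᵇ < count Sᵇ
    X<S = <-≤-trans (m<m+n (count Xᵇ) (s≤s z≤n)) X+2≤S

    small : SmallSumset Sᵇ -A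
    small = begin
      count D +ℕ 2                  ≤⟨ +-monoˡ-≤ 2 count-D≤ ⟩
      count A +ℕ count Xᵇ +ℕ 2      ≡⟨ +-assoc (count A) _ _ ⟩
      count A +ℕ (count Xᵇ +ℕ 2)    ≤⟨ +-monoʳ-≤ (count A) X+2≤S ⟩
      count A +ℕ count Sᵇ           ≡⟨ +-comm (count A) _ ⟩
      count Sᵇ +ℕ count A           ≡⟨ cong (count Sᵇ +ℕ_) count-A≡count-[-A] ⟩
      count Sᵇ +ℕ count -A          ∎
      where open ≤-Reasoning

    D-small : count D < count -A +ℕ p
    D-small = begin-strict
      count D               ≤⟨ count-D≤ ⟩
      count A +ℕ count Xᵇ   <⟨ +-monoʳ-< (count A) X<p ⟩
      count A +ℕ p          ≡⟨ cong (_+ℕ p) count-A≡count-[-A] ⟩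
      count -A +ℕ p         ∎
      where open ≤-Reasoning

    H : Pred order
    H = stabiliser D

    p≤H : p ≤ count H
    p≤H = let s , Ss = count-pos⇒∃ Sᵇ (≤-trans (s≤s z≤n) (≤-trans (m≤n+m 2 _) X+2≤S))
          in p≤count-stabiliser large {Sᵇ} { -A} Ss small
               (differences-are-periods large order (count≤n Sᵇ) Ss small D-small)

    X<H : count Xᵇ < count H
    X<H = <-≤-trans X<p p≤H

    H∋- : ∀ {h} → H ∋ h → H ∋ - h
    H∋- h∈ = Period⇒stabiliser D (Period-neg D (stabiliser⇒Period D h∈))

    A+H-closed : ∀ {a h} → A ∋ a → H ∋ h → Xᵇ ∌ a + h → A ∋ a + h
    A+H-closed {a} {h} Aa h∈ Xᵇ∌a+h =
      let s , Ss , Xᵇ∌c = count<⇒∃∌ Sᵇ Xᵇ (_- (a + h)) (+-cancelʳ (- (a + h))) X<S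
          D∋c = subst (D ∋_) (x-y-z≡x-[y+z] s a h) (proj₂ (stabiliser⇒Period D h∈ _ (D∋s-a Ss Aa)))
          c+[a+h]≡s = //-rightDividesˡ (a + h) s
      in A-closed (D∖X⊆A D∋c Xᵇ∌c) (∌⇒∉ Xᵇ∌a+h) (∋⇒∈ (subst (Sᵇ ∋_) (sym c+[a+h]≡s) Ss))

    W : Pred order
    W = H ⊞ A

    W-closed : ∀ {z w} → W ∋ z → Adj⁺ G S z w → W ∋ w
    W-closed {z} {w} z∈ adj =
      let h , h∈ , Az-h = ⊞⁻ {H} {A} z∈
          D∋h+w = subst (D ∋_) (x+y-[x-z]≡z+y z w h) (D∋s-a (∈⇒∋ adj) Az-h)
          D∋w = subst (D ∋_) (x+y-x≡y h w) (proj₂ (stabiliser⇒Period D h∈ _ D∋h+w))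
          h′ , h′∈ , Xᵇ∌w+h′ = count<⇒∃∌ H Xᵇ (w +_) (+-cancelˡ w) X<H
          A∋w+h′ = D∖X⊆A (proj₁ (stabiliser⇒Period D h′∈ w D∋w)) Xᵇ∌w+h′
      in ⊞-intro {H} {A} (- h′) (H∋- h′∈)
           (subst (A ∋_) (cong (w +_) (sym (⁻¹-involutive h′))) A∋w+h′)

    closed-reaches : ∀ {x y} → A ∋ x → Walk G S (∅ G) x y → y ∉ X → A ∋ y
    closed-reaches {x} {y} Ax walk y∉X =
      let W∋x = ⊞-intro {H} {A} 0# (Period⇒stabiliser D (Period-0 D))
                  (subst (A ∋_) (sym (x-0≡x x)) Ax)
          h , h∈ , Ay-h = ⊞⁻ {H} {A} (walk-preserves W W-closed walk W∋x)
          y-h+h≡y = //-rightDividesˡ h y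
      in subst (A ∋_) y-h+h≡y (A+H-closed Ay-h h∈ (subst (Xᵇ ∌_) (sym y-h+h≡y) (∉⇒∌ y∉X)))

  module Reachability (S X : Subset order) (x : Element) where

    Sᵇ Xᵇ : Pred order
    Sᵇ = lookup S
    Xᵇ = lookup X

    step : Pred order → Pred order
    step R w = R w ∨ (not (Xᵇ w) ∧ any λ z → R z ∧ Sᵇ (z + w))

    closure : ℕ → Pred order → Pred order
    closure ℕ.zero R = R
    closure (ℕ.suc k) R = if any (step R ∖ R) then closure k (step R) else R

    ⊆-closure : ∀ k R → R ⊆ closure k R
    ⊆-closure ℕ.zero R _ Rz = Rz
    ⊆-closure (ℕ.suc k) R z Rz with any (step R ∖ R)
    ... | true = ⊆-closure k (step R) z (∨-true⁺ˡ Rz)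
    ... | false = Rz

    Reached : Pred order → Set
    Reached R = ∀ {z} → R ∋ z → Walk G S X x z

    _∷ʳ_ : ∀ {a b c} → Walk G S X a b → Adj⁺ G S b c × c ∉ X → Walk G S X a c
    [] ∷ʳ edge = edge ∷ []
    (edge′ ∷ walk) ∷ʳ edge = edge′ ∷ (walk ∷ʳ edge)

    step-reached : ∀ {R} → Reached R → Reached (step R)
    step-reached {R} reached {w} w∈ with ∨-true⁻ {R w} w∈
    ... | inj₁ Rw = reached Rw
    ... | inj₂ e = let z , z∈ = any⁻ (λ z → R z ∧ Sᵇ (z + w)) (∧-true⁻ʳ {not (Xᵇ w)} e)
                   in reached (∧-true⁻ˡ z∈) ∷ʳ (∋⇒∈ (∧-true⁻ʳ z∈) , ∌⇒∉ (not-true⁻ (∧-true⁻ˡ e)))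

    closure-reached : ∀ k {R} → Reached R → Reached (closure k R)
    closure-reached ℕ.zero reached = reached
    closure-reached (ℕ.suc k) {R} reached with any (step R ∖ R)
    ... | true = closure-reached k (step-reached reached)
    ... | false = reached

    step-stable⇒closed : ∀ R → (∀ w → (step R ∖ R) ∌ w) → Closed S X R
    step-stable⇒closed R stable {z} {w} Rz w∉X adj = not-false⁻ (∧-false⁻ (stable w) step∋w)
      where
      step∋w : step R ∋ w
      step∋w = ∨-true⁺ʳ {R w} (∧-true⁺ (not-true⁺ (∉⇒∌ w∉X))
                 (any⁺ (λ z → R z ∧ Sᵇ (z + w)) z (∧-true⁺ Rz (∈⇒∋ adj))))

    -- k is fuel: every step that is not yet stable adds a vertex.
    closure-closed : ∀ k R → order < count R +ℕ k → Closed S X (closure k R)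
    closure-closed ℕ.zero R order<R =
      ⊥-elim (<⇒≱ order<R (≤-trans (≤-reflexive (+-identityʳ _)) (count≤n R)))
    closure-closed (ℕ.suc k) R order<R+1+k with any (step R ∖ R) in e
    ... | true = closure-closed k (step R) (begin-strict
          order                 <⟨ order<R+1+k ⟩
          count R +ℕ ℕ.suc k    ≡⟨ +-suc (count R) k ⟩
          ℕ.suc (count R) +ℕ k  ≤⟨ +-monoˡ-≤ k R<step ⟩
          count (step R) +ℕ k   ∎)
      where
      open ≤-Reasoning
      R<step : count R < count (step R)
      R<step = let w , w∈ = any⁻ (step R ∖ R) e
               in count-< {P = R} {step R} (λ _ → ∨-true⁺ˡ) (∧-true⁻ˡ w∈) (not-true⁻ (∧-true⁻ʳ w∈))
    ... | false = step-stable⇒closed R (any-false⁻ _ e)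

  stabiliser-isNonzeroSubgroup : ∀ P {h} → h ≢ 0# → Period P h →
    IsNonzeroSubgroup G (tabulate (stabiliser P))
  stabiliser-isNonzeroSubgroup P {h} h≢0 period =
    ( ∈H (Period-0 P)
    , (λ a b a∈ b∈ → ∈H (Period-+ P (∈H⇒Period a∈) (∈H⇒Period b∈)))
    , (λ a a∈ → ∈H (Period-neg P (∈H⇒Period a∈))) )
    , h , ∈H period , h≢0
    where
    ∈H : ∀ {a} → Period P a → a ∈ tabulate (stabiliser P)
    ∈H = ∈tabulate⁺ (stabiliser P) ∘ Period⇒stabiliser P
    ∈H⇒Period : ∀ {a} → a ∈ tabulate (stabiliser P) → Period P a
    ∈H⇒Period = stabiliser⇒Period P ∘ ∈tabulate⁻ (stabiliser P)

  minimal-subgroups⇒NonzeroStabilisersHaveSize≥ : ∀ {p} →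
    (∀ H → IsNonzeroSubgroup G H → p ≤ ∣ H ∣) → NonzeroStabilisersHaveSize≥ p
  minimal-subgroups⇒NonzeroStabilisersHaveSize≥ minimal P h≢0 period =
    subst (_ ≤_) (∣tabulate∣≡count (stabiliser P))
      (minimal _ (stabiliser-isNonzeroSubgroup P h≢0 period))

  connected-without-small-set : ∀ S X {p} → NonzeroStabilisersHaveSize≥ p →
    ∣ X ∣ +ℕ 2 ≤ ∣ S ∣ → ∣ X ∣ < p → Connected G S → ConnectedWithout G S X
  connected-without-small-set S X large X+2≤S X<p connected x y _ y∉X =
    closure-reached order (λ z∈ → subst (Walk G S X x) (sym (｛j｝∋i⇒i≡j z∈)) []) R∋y
    where
    open Reachability S X x
    R : Pred order
    R = closure order ｛ x ｝
    R-closed : Closed S X R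
    R-closed = closure-closed order ｛ x ｝ (+-monoˡ-≤ order (count-pos ｛ x ｝ {x} (｛j｝∋j x)))
    open Separation S X large (subst₂ (λ a b → a +ℕ 2 ≤ b) (∣∣≡count X) (∣∣≡count S) X+2≤S)
      (subst (_< _) (∣∣≡count X) X<p) R-closed
    R∋y : R ∋ y
    R∋y = closed-reaches (⊆-closure order ｛ x ｝ x (｛j｝∋j x)) (connected x y ∉⊥ ∉⊥) y∉X

  ∣S∣<order : ∀ {S} → Proper G S → ∣ S ∣ < order
  ∣S∣<order {S} (g , g∉S) = begin-strict
    ∣ S ∣                     ≡⟨ ∣∣≡count S ⟩
    count (lookup S)          <⟨ count-< {P = lookup S} {λ _ → true} (λ _ _ → refl) refl (∉⇒∌ g∉S) ⟩
    count {order} (λ _ → true) ≤⟨ count≤n _ ⟩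
    order                     ∎
    where open ≤-Reasoning

  small-sets-do-not-separate : ∀ {S X p} → Proper G S → NonzeroStabilisersHaveSize≥ p →
    Connected G S → ∣ X ∣ +ℕ 2 ≤ ∣ S ∣ → ∣ X ∣ < p → ¬ Separates G S X
  small-sets-do-not-separate {S} {X} _ large connected X+2≤S X<p (inj₁ disconnected) =
    disconnected (connected-without-small-set S X large X+2≤S X<p connected)
  small-sets-do-not-separate {S} {X} proper _ _ X+2≤S _ (inj₂ one-vertex-left) =
    <-irrefl refl (begin-strict
      order                     ≤⟨ m≤n+m∸n order ∣ X ∣ ⟩
      ∣ X ∣ +ℕ (order ∸ ∣ X ∣)  ≤⟨ +-monoʳ-≤ ∣ X ∣ one-vertex-left ⟩
      ∣ X ∣ +ℕ 1                <⟨ +-monoʳ-< ∣ X ∣ (s≤s (s≤s z≤n)) ⟩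
      ∣ X ∣ +ℕ 2                ≤⟨ X+2≤S ⟩
      ∣ S ∣                     <⟨ ∣S∣<order proper ⟩
      order                     ∎)
    where open ≤-Reasoning

  κ≥∣S∣∸1⊓p : ∀ {S p} → Proper G S → NonzeroStabilisersHaveSize≥ p → Connected G S →
    κ≥ G S ((∣ S ∣ ∸ 1) ⊓ p)
  κ≥∣S∣∸1⊓p {S} {p} proper large connected X separates with (∣ S ∣ ∸ 1) ⊓ p ≤? ∣ X ∣
  ... | yes κ≤X = κ≤X
  ... | no κ≰X = ⊥-elim (small-sets-do-not-separate proper large connected
                   (1+m≤n∸1⇒m+2≤n ∣ S ∣ (≤-trans X<κ (m⊓n≤m _ p)))
                   (≤-trans X<κ (m⊓n≤n _ p)) separates)
    where
    X<κ : ∣ X ∣ < (∣ S ∣ ∸ 1) ⊓ p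
    X<κ = ≰⇒> κ≰X
    1+m≤n∸1⇒m+2≤n : ∀ {m} n → ℕ.suc m ≤ n ∸ 1 → m +ℕ 2 ≤ n
    1+m≤n∸1⇒m+2≤n {m} (ℕ.suc n) m<n = subst (_≤ ℕ.suc n) (+-comm 2 m) (s≤s m<n)

corollary5 : (G : FinAbGroup) → NonTrivial G →
    (S : Subset (FinAbGroup.order G)) → Proper G S →
    (p : ℕ) → IsSmallestNonzeroSubgroupOrder G p →
    Connected G S →
    κ≥ G S ((∣ S ∣ ∸ 1) ⊓ p)
corollary5 G _ _ proper _ (_ , minimal) =
  κ≥∣S∣∸1⊓p G proper (minimal-subgroups⇒NonzeroStabilisersHaveSize≥ G minimal)
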